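{- The following procedure is correct, i.e., for every input formula $F$ that encodes a logic program, its output $P$ is a logic program with $\mathsf{S}_F \models \gamma(P) \leftrightarrow F$, $\mathit{Pred}(P) \subseteq \mathit{Pred}^{LP}(F)$ and $\mathit{Fun}(P) \subseteq \mathit{Fun}(F)$. Procedure: Input a $0/1$-superscripted first-order formula $F$ that encodes a logic program. (1) Bring $F$ into conjunctive normal form $\forall\bar{x}\,(M_0\wedge M_1)$, where $M_0$, $M_1$ are clausal formulas, every clause of $M_0$ contains a literal whose predicate has superscript $0$, and in every clause of $M_1$ all predicates have superscript $1$. (2) Partition $M_1$ into clausal formulas $M_1'$ and $M_1''$ such that $\forall\bar{x}\,\mathit{rename}_{0\mapsto1}(M_0)\models\forall\bar{x}\,M_1''$ (e.g. $M_1'=M_1$, $M_1''=\top$, or put a clause $C$ of $M_1$ into $M_1''$ iff $\mathit{rename}_{0\mapsto1}(D)$ subsumes $C$ for some clause $D$ of $M_0$). (3) Let $P$ be the set of rules $A_1;\ldots;A_k;\mathbf{not}\,A_{k+1};\ldots;\mathbf{not}\,A_l\leftarrow A_{l+1},\ldots,A_m,\mathbf{not}\,A_{m+1},\ldots,\mathbf{not}\,A_n$, one for each clause $\bigwedge_{i=l+1}^m A_i^0\wedge\bigwedge_{i=m+1}^n\lnot A_i^1\rightarrow\bigvee_{i=1}^k A_i^0\vee\bigvee_{i=k+1}^l\lnot A_i^1$ in $M_0\wedge M_1'$. Output $P$.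
   Context: Logic programs are sets of rules $A_1;\ldots;A_k;\mathbf{not}\,A_{k+1};\ldots;\mathbf{not}\,A_l \leftarrow A_{l+1},\ldots,A_m,\mathbf{not}\,A_{m+1},\ldots,\mathbf{not}\,A_n.$ with atoms $A_i$, $0\le k\le l\le m\le n$. For each program predicate $p$ there are first-order predicates $p^0,p^1$ of the same arity ($0/1$-superscripted formulas use only these); $A^0$, $A^1$ denote atom $A$ with $p$ replaced by $p^0$, $p^1$. For a rule $R$ with variables $\bar{x}$: $\gamma^0(R)=\forall\bar{x}\,(\bigwedge_{i=l+1}^m A_i^0\wedge\bigwedge_{i=m+1}^n\lnot A_i^1 \rightarrow \bigvee_{i=1}^k A_i^0\vee\bigvee_{i=k+1}^l\lnot A_i^1)$, $\gamma^1(R)$ is the same with every $A_i^0$ replaced by $A_i^1$, and $\gamma(P)=\bigwedge_{R\in P}\gamma^0(R)\wedge\bigwedge_{R\in P}\gamma^1(R)$. $\mathit{Pred}$, $\mathit{Fun}$ give the occurring predicates and functions (including constants); $\mathit{Pred}^{LP}(F)=\{p\mid p^i\in\mathit{Pred}(F),\ i\in\{0,1\}\}$. $\mathsf{S}_F=\bigwedge_{p\in\mathit{Pred}^{LP}(F)}\forall\bar{x}\,(p^0(\bar{x})\rightarrow p^1(\bar{x}))$. $\mathit{rename}_{0\mapsto1}(F)$ replaces every $p^0$ in $F$ by $p^1$. A formula is universal if $\forall$ occurs only positively and $\exists$ only negatively. $F$ encodes a logic program iff $F$ is universal and $\mathsf{S}_F\wedge F\models\mathit{rename}_{0\mapsto1}(F)$.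 -}

module Defs where

open import Data.Nat using (ℕ; _≡ᵇ_)
open import Data.Bool using (Bool; true; false; if_then_else_; T; not)
open import Data.List using (List; []; _∷_; _++_; map; foldr; concatMap; filter)
open import Data.List.Relation.Unary.All using (All)
open import Data.List.Relation.Unary.Any using (Any)
open import Data.List.Relation.Binary.Subset.Propositional using (_⊆_)
open import Data.List.Relation.Binary.Permutation.Propositional using (_↭_)
open import Data.Vec using (Vec; []; _∷_)
open import Data.Product using (_×_; _,_; proj₂)
open import Data.Unit using (⊤)
open import Data.Empty using (⊥)
open import Relation.Nullary using (¬_)
open import Relation.Binary.PropositionalEquality using (_≡_)
open import Level using (Level; suc; zero)

-- Function symbols (constants are arity-0 function symbols).
record FSym : Set where
  constructor fsym
  field
    name  : ℕ
    arity : ℕ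

record PSym : Set where
  constructor psym
  field
    name  : ℕ
    arity : ℕ

data Sup : Set where
  s0 s1 : Sup

data Term : Set where
  var : ℕ → Term
  app : (f : FSym) → Vec Term (FSym.arity f) → Term

record PAtom : Set where
  constructor patom
  field
    pred : PSym
    args : Vec Term (PSym.arity pred)

record Atom : Set where
  constructor atom
  field
    sup : Sup
    pa  : PAtom

_⁰ : PAtom → Atom
A ⁰ = atom s0 A

_¹ : PAtom → Atom
A ¹ = atom s1 A

infixr 6 _∧ᶠ_
infixr 5 _∨ᶠ_
infixr 4 _⇒ᶠ_ _⇔ᶠ_

data Formula : Set where
  ⊤ᶠ ⊥ᶠ : Formula
  atomᶠ : Atom → Formula
  ¬ᶠ_   : Formula → Formula
  _∧ᶠ_ _∨ᶠ_ _⇒ᶠ_ _⇔ᶠ_ : Formula → Formula → Formula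
  ∀ᶠ ∃ᶠ : ℕ → Formula → Formula

∀* : List ℕ → Formula → Formula
∀* xs φ = foldr ∀ᶠ φ xs

⋀ : List Formula → Formula
⋀ = foldr _∧ᶠ_ ⊤ᶠ

⋁ : List Formula → Formula
⋁ = foldr _∨ᶠ_ ⊥ᶠ

mutual
  funsT : Term → List FSym
  funsT (var x)    = []
  funsT (app f ts) = f ∷ funsTs ts

  funsTs : ∀ {n} → Vec Term n → List FSym
  funsTs []       = []
  funsTs (t ∷ ts) = funsT t ++ funsTs ts

mutual
  varsT : Term → List ℕ
  varsT (var x)    = x ∷ []
  varsT (app f ts) = varsTs ts

  varsTs : ∀ {n} → Vec Term n → List ℕ
  varsTs []       = []
  varsTs (t ∷ ts) = varsT t ++ varsTs ts

funsPA : PAtom → List FSym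
funsPA (patom p ts) = funsTs ts

varsPA : PAtom → List ℕ
varsPA (patom p ts) = varsTs ts

Pred : Formula → List (Sup × PSym)
Pred ⊤ᶠ = []
Pred ⊥ᶠ = []
Pred (atomᶠ (atom i A)) = (i , PAtom.pred A) ∷ []
Pred (¬ᶠ φ) = Pred φ
Pred (φ ∧ᶠ ψ) = Pred φ ++ Pred ψ
Pred (φ ∨ᶠ ψ) = Pred φ ++ Pred ψ
Pred (φ ⇒ᶠ ψ) = Pred φ ++ Pred ψ
Pred (φ ⇔ᶠ ψ) = Pred φ ++ Pred ψ
Pred (∀ᶠ x φ) = Pred φ
Pred (∃ᶠ x φ) = Pred φ

PredLP : Formula → List PSym
PredLP F = map proj₂ (Pred F)

Fun : Formula → List FSym
Fun ⊤ᶠ = []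
Fun ⊥ᶠ = []
Fun (atomᶠ (atom i A)) = funsPA A
Fun (¬ᶠ φ) = Fun φ
Fun (φ ∧ᶠ ψ) = Fun φ ++ Fun ψ
Fun (φ ∨ᶠ ψ) = Fun φ ++ Fun ψ
Fun (φ ⇒ᶠ ψ) = Fun φ ++ Fun ψ
Fun (φ ⇔ᶠ ψ) = Fun φ ++ Fun ψ
Fun (∀ᶠ x φ) = Fun φ
Fun (∃ᶠ x φ) = Fun φ

rename₀₁ : Formula → Formula
rename₀₁ ⊤ᶠ = ⊤ᶠ
rename₀₁ ⊥ᶠ = ⊥ᶠ
rename₀₁ (atomᶠ (atom i A)) = atomᶠ (atom s1 A)
rename₀₁ (¬ᶠ φ) = ¬ᶠ rename₀₁ φ
rename₀₁ (φ ∧ᶠ ψ) = rename₀₁ φ ∧ᶠ rename₀₁ ψ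
rename₀₁ (φ ∨ᶠ ψ) = rename₀₁ φ ∨ᶠ rename₀₁ ψ
rename₀₁ (φ ⇒ᶠ ψ) = rename₀₁ φ ⇒ᶠ rename₀₁ ψ
rename₀₁ (φ ⇔ᶠ ψ) = rename₀₁ φ ⇔ᶠ rename₀₁ ψ
rename₀₁ (∀ᶠ x φ) = ∀ᶠ x (rename₀₁ φ)
rename₀₁ (∃ᶠ x φ) = ∃ᶠ x (rename₀₁ φ)

-- Universal formulas: ∀ occurs only positively, ∃ only negatively.
-- PosOK φ / NegOK φ: φ, occurring positively / negatively, respects this.
mutual
  PosOK : Formula → Set
  PosOK ⊤ᶠ = ⊤
  PosOK ⊥ᶠ = ⊤
  PosOK (atomᶠ a) = ⊤
  PosOK (¬ᶠ φ) = NegOK φ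
  PosOK (φ ∧ᶠ ψ) = PosOK φ × PosOK ψ
  PosOK (φ ∨ᶠ ψ) = PosOK φ × PosOK ψ
  PosOK (φ ⇒ᶠ ψ) = NegOK φ × PosOK ψ
  PosOK (φ ⇔ᶠ ψ) = (PosOK φ × NegOK φ) × (PosOK ψ × NegOK ψ)
  PosOK (∀ᶠ x φ) = PosOK φ
  PosOK (∃ᶠ x φ) = ⊥

  NegOK : Formula → Set
  NegOK ⊤ᶠ = ⊤
  NegOK ⊥ᶠ = ⊤
  NegOK (atomᶠ a) = ⊤
  NegOK (¬ᶠ φ) = PosOK φ
  NegOK (φ ∧ᶠ ψ) = NegOK φ × NegOK ψ
  NegOK (φ ∨ᶠ ψ) = NegOK φ × NegOK ψ
  NegOK (φ ⇒ᶠ ψ) = PosOK φ × NegOK ψ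
  NegOK (φ ⇔ᶠ ψ) = (PosOK φ × NegOK φ) × (PosOK ψ × NegOK ψ)
  NegOK (∀ᶠ x φ) = ⊥
  NegOK (∃ᶠ x φ) = NegOK φ

Universal : Formula → Set
Universal = PosOK

record Structure : Set₁ where
  field
    Dom  : Set
    elem : Dom                       -- domains are nonempty
    fun  : (f : FSym) → Vec Dom (FSym.arity f) → Dom
    rel  : Sup → (p : PSym) → Vec Dom (PSym.arity p) → Bool

open Structure public

Assignment : Structure → Set
Assignment M = ℕ → Dom M

_[_↦_] : {M : Structure} → Assignment M → ℕ → Dom M → Assignment M
(_[_↦_] {M} σ x d) y = if y ≡ᵇ x then d else σ y

module _ (M : Structure) (σ : Assignment M) where
  mutual
    evalT : Term → Dom M
    evalT (var x)    = σ x
    evalT (app f ts) = fun M f (evalTs ts)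

    evalTs : ∀ {n} → Vec Term n → Vec (Dom M) n
    evalTs []       = []
    evalTs (t ∷ ts) = evalT t ∷ evalTs ts

-- Satisfaction.  Atoms are two-valued; ∨ and ∃ are given their classical
-- meaning via De Morgan, so that the semantics is the classical one.
Sat : (M : Structure) → Assignment M → Formula → Set
Sat M σ ⊤ᶠ = ⊤
Sat M σ ⊥ᶠ = ⊥
Sat M σ (atomᶠ (atom i (patom p ts))) = T (rel M i p (evalTs M σ ts))
Sat M σ (¬ᶠ φ) = ¬ Sat M σ φ
Sat M σ (φ ∧ᶠ ψ) = Sat M σ φ × Sat M σ ψ
Sat M σ (φ ∨ᶠ ψ) = ¬ (¬ Sat M σ φ × ¬ Sat M σ ψ)
Sat M σ (φ ⇒ᶠ ψ) = Sat M σ φ → Sat M σ ψ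
Sat M σ (φ ⇔ᶠ ψ) = (Sat M σ φ → Sat M σ ψ) × (Sat M σ ψ → Sat M σ φ)
Sat M σ (∀ᶠ x φ) = (d : Dom M) → Sat M (_[_↦_] {M} σ x d) φ
Sat M σ (∃ᶠ x φ) = ¬ ((d : Dom M) → ¬ Sat M (_[_↦_] {M} σ x d) φ)

_⊨_ : Formula → Formula → Set₁
F ⊨ G = (M : Structure) (σ : Assignment M) → Sat M σ F → Sat M σ G

_≡ᶠ_ : Formula → Formula → Set₁
F ≡ᶠ G = (F ⊨ G) × (G ⊨ F)

-- A structure satisfies S_F = ⋀_{p ∈ Pred^LP(F)} ∀x̄ (p^0(x̄) → p^1(x̄)).
SatS : Formula → Structure → Set
SatS F M = (p : PSym) → Any (p ≡_) (PredLP F) →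
  (ds : Vec (Dom M) (PSym.arity p)) → T (rel M s0 p ds) → T (rel M s1 p ds)

_∣S⊨_ : Formula → Formula → Set₁
F ∣S⊨ G = (M : Structure) (σ : Assignment M) → SatS F M → Sat M σ G

EncodesLP : Formula → Set₁
EncodesLP F = Universal F ×
  ((M : Structure) (σ : Assignment M) →
     SatS F M → Sat M σ F → Sat M σ (rename₀₁ F))

record Literal : Set where
  constructor lit
  field
    positive : Bool
    latom    : Atom

Clause : Set
Clause = List Literal

litF : Literal → Formula
litF (lit true a)  = atomᶠ a
litF (lit false a) = ¬ᶠ atomᶠ a

clauseF : Clause → Formula
clauseF c = ⋁ (map litF c)

cnf : List Clause → Formula
cnf cs = ⋀ (map clauseF cs)

litSup : Literal → Sup
litSup l = Atom.sup (Literal.latom l)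

Has0 : Clause → Set
Has0 c = Any (λ l → litSup l ≡ s0) c

All1 : Clause → Set
All1 c = All (λ l → litSup l ≡ s1) c

clauseVars : Clause → List ℕ
clauseVars c = concatMap (λ l → varsPA (Atom.pa (Literal.latom l))) c

-- A₁;…;A_k; not A_{k+1};…; not A_l ← A_{l+1},…,A_m, not A_{m+1},…, not A_n
record Rule : Set where
  constructor rule
  field
    headPos : List PAtom
    headNeg : List PAtom
    bodyPos : List PAtom
    bodyNeg : List PAtom

Program : Set
Program = List Rule

ruleAtoms : Rule → List PAtom
ruleAtoms (rule hp hn bp bn) = hp ++ hn ++ bp ++ bn

ruleVars : Rule → List ℕ
ruleVars r = concatMap varsPA (ruleAtoms r)

γʳ : Sup → Rule → Formula
γʳ i r@(rule hp hn bp bn) =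
  ∀* (ruleVars r)
    (⋀ (map (λ A → atomᶠ (atom i A)) bp) ∧ᶠ ⋀ (map (λ A → ¬ᶠ atomᶠ (A ¹)) bn)
      ⇒ᶠ ⋁ (map (λ A → atomᶠ (atom i A)) hp) ∨ᶠ ⋁ (map (λ A → ¬ᶠ atomᶠ (A ¹)) hn))

γ : Program → Formula
γ P = ⋀ (map (γʳ s0) P) ∧ᶠ ⋀ (map (γʳ s1) P)

PredP : Program → List PSym
PredP P = concatMap (λ r → map PAtom.pred (ruleAtoms r)) P

FunP : Program → List FSym
FunP P = concatMap (λ r → concatMap funsPA (ruleAtoms r)) P

-- Step (3) of the procedure: clause ↦ rule.
-- Positive A^0 ↦ head A;  negative A^1 ↦ head "not A";
-- negative A^0 ↦ body A;  positive A^1 ↦ body "not A".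

_==ˢ_ : Sup → Sup → Bool
s0 ==ˢ s0 = true
s1 ==ˢ s1 = true
_  ==ˢ _  = false

_==ᵇ_ : Bool → Bool → Bool
true  ==ᵇ true  = true
false ==ᵇ false = true
_     ==ᵇ _     = false

select : Bool → Sup → Clause → List PAtom
select b i [] = []
select b i (lit b' (atom j A) ∷ c) =
  if (b ==ᵇ b') Data.Bool.∧ (i ==ˢ j) then A ∷ select b i c else select b i c

clauseToRule : Clause → Rule
clauseToRule c =
  rule (select true s0 c) (select false s1 c) (select false s0 c) (select true s1 c)

procedure : List Clause → List Clause → Program
procedure M₀ M₁' = map clauseToRule (M₀ ++ M₁')

{-# OPTIONS --safe #-}
module Submission where

-- Write Mⁱ (reading i M below) for M with every p⁰ interpreted as pⁱ.  For the rule
-- R_C of a clause C, γⁱ(R_C) holds in M iff C holds universally in Mⁱ, and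
-- rename₀₁ φ holds in M iff φ holds in M¹; so γ(P) says that M₀ ∧ M₁' holds in M
-- and in M¹.  Given γ(P), M₀ holds in M¹, hence rename₀₁(M₀) and by (2) also M₁''
-- hold in M, and with them F.  Conversely F holds in M and, as F encodes a logic
-- program and M ⊨ S_F, rename₀₁ F holds in M, i.e. F holds in M¹; so every clause
-- of M₀ ∧ M₁ holds in both.  Rules and clauses are compared through Boolean truth
-- values, which quantifier-free formulas have because atoms are two-valued.

open import Defs
open import Data.Nat using (ℕ; _≡ᵇ_)
open import Data.Nat.Properties using (≡ᵇ⇒≡; ≡⇒≡ᵇ)
open import Data.Bool.Properties using (not-involutive)
open import Data.Bool using (Bool; true; false; T; not; _∧_; _∨_; if_then_else_)
open import Data.List using (List; []; _∷_; _++_; map; concatMap)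
open import Data.List.Relation.Unary.All as All using (All; []; _∷_)
import Data.List.Relation.Unary.All.Properties as Allₚ
open import Data.List.Relation.Unary.Any using (here; there)
open import Data.List.Membership.Propositional using (_∈_; lose)
open import Data.List.Membership.Propositional.Properties
  using (∈-++⁺ˡ; ∈-++⁺ʳ; ∈-++⁻; ∈-map⁺; ∈-map⁻; ∈-concatMap⁺)
open import Data.List.Relation.Binary.Subset.Propositional using (_⊆_)
import Data.List.Relation.Binary.Subset.Propositional.Properties as Subset
open import Data.List.Relation.Binary.Permutation.Propositional using (_↭_; ↭-sym)
open import Data.List.Relation.Binary.Permutation.Propositional.Properties using (All-resp-↭)
open import Data.Product using (_×_; _,_; proj₁; proj₂)
open import Data.Sum using (inj₁; inj₂; [_,_]′)
open import Data.Unit using (⊤; tt)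
open import Data.Empty using (⊥)
open import Data.Vec using (Vec; []; _∷_)
open import Function using (_∘_; id; case_of_)
open import Relation.Nullary using (contradiction)
open import Relation.Nullary.Reflects
  using (Reflects; ofʸ; ofⁿ; of; T-reflects; ¬-reflects; _×-reflects_; _→-reflects_)
open import Relation.Binary.PropositionalEquality using (_≡_; refl; sym; trans; cong; cong₂; subst)

variable
  φ ψ : Formula
  xs : List ℕ

++-⊆ : ∀ {A : Set} {xs ys zs : List A} → xs ⊆ zs → ys ⊆ zs → xs ++ ys ⊆ zs
++-⊆ {xs = xs} xs⊆ ys⊆ = [ xs⊆ , ys⊆ ]′ ∘ ∈-++⁻ xs

concatMap-⊆ : ∀ {A B : Set} {f : A → List B} {xs : List A} {ys : List B} →
              (∀ {x} → x ∈ xs → f x ⊆ ys) → concatMap f xs ⊆ ys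
concatMap-⊆ {xs = []}     _   ()
concatMap-⊆ {xs = x ∷ xs} fx⊆ = ++-⊆ (fx⊆ (here refl)) (concatMap-⊆ (fx⊆ ∘ there))

concatMap-∈ : ∀ {A B : Set} (f : A → List B) {x : A} {xs : List A} →
              x ∈ xs → f x ⊆ concatMap f xs
concatMap-∈ f x∈ y∈ = ∈-concatMap⁺ f (lose x∈ y∈)

-- reading s0 M is M itself, by η for records.
reading : Sup → Structure → Structure
reading i M = record M { rel = rel′ i }
  where
  rel′ : Sup → Sup → (p : PSym) → Vec (Dom M) (PSym.arity p) → Bool
  rel′ s0 = rel M
  rel′ s1 = λ _ → rel M s1

module _ {M : Structure} {σ : Assignment M} where
  mutual
    evalT-reading : ∀ i (t : Term) → evalT (reading i M) σ t ≡ evalT M σ t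
    evalT-reading i (var x)    = refl
    evalT-reading i (app f ts) = cong (fun M f) (evalTs-reading i ts)

    evalTs-reading : ∀ i {n} (ts : Vec Term n) → evalTs (reading i M) σ ts ≡ evalTs M σ ts
    evalTs-reading i []       = refl
    evalTs-reading i (t ∷ ts) = cong₂ _∷_ (evalT-reading i t) (evalTs-reading i ts)

module _ {M : Structure} {σ ρ : Assignment M} where
  mutual
    evalT-coincidence : ∀ (t : Term) → (∀ {x} → x ∈ varsT t → σ x ≡ ρ x) →
                        evalT M σ t ≡ evalT M ρ t
    evalT-coincidence (var x)    agree = agree (here refl)
    evalT-coincidence (app f ts) agree = cong (fun M f) (evalTs-coincidence ts agree)

    evalTs-coincidence : ∀ {n} (ts : Vec Term n) → (∀ {x} → x ∈ varsTs ts → σ x ≡ ρ x) →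
                         evalTs M σ ts ≡ evalTs M ρ ts
    evalTs-coincidence []       agree = refl
    evalTs-coincidence (t ∷ ts) agree =
      cong₂ _∷_ (evalT-coincidence t (agree ∘ ∈-++⁺ˡ)) (evalTs-coincidence ts (agree ∘ ∈-++⁺ʳ _))

module _ {M : Structure} where
  mutual
    rename₀₁⁺ : ∀ {σ} φ → Sat (reading s1 M) σ φ → Sat M σ (rename₀₁ φ)
    rename₀₁⁺ ⊤ᶠ       s       = s
    rename₀₁⁺ ⊥ᶠ       s       = s
    rename₀₁⁺ (atomᶠ (atom i (patom p ts))) s = subst (T ∘ rel M s1 p) (evalTs-reading s1 ts) s
    rename₀₁⁺ (¬ᶠ φ)   s       = s ∘ rename₀₁⁻ φ
    rename₀₁⁺ (φ ∧ᶠ ψ) (s , t) = rename₀₁⁺ φ s , rename₀₁⁺ ψ t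
    rename₀₁⁺ (φ ∨ᶠ ψ) s (¬s , ¬t) = s (¬s ∘ rename₀₁⁺ φ , ¬t ∘ rename₀₁⁺ ψ)
    rename₀₁⁺ (φ ⇒ᶠ ψ) s       = rename₀₁⁺ ψ ∘ s ∘ rename₀₁⁻ φ
    rename₀₁⁺ (φ ⇔ᶠ ψ) (s , t) = rename₀₁⁺ ψ ∘ s ∘ rename₀₁⁻ φ , rename₀₁⁺ φ ∘ t ∘ rename₀₁⁻ ψ
    rename₀₁⁺ (∀ᶠ x φ) s d     = rename₀₁⁺ φ (s d)
    rename₀₁⁺ (∃ᶠ x φ) s ¬s    = s (λ d → ¬s d ∘ rename₀₁⁺ φ)

    rename₀₁⁻ : ∀ {σ} φ → Sat M σ (rename₀₁ φ) → Sat (reading s1 M) σ φ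
    rename₀₁⁻ ⊤ᶠ       s       = s
    rename₀₁⁻ ⊥ᶠ       s       = s
    rename₀₁⁻ (atomᶠ (atom i (patom p ts))) s = subst (T ∘ rel M s1 p) (sym (evalTs-reading s1 ts)) s
    rename₀₁⁻ (¬ᶠ φ)   s       = s ∘ rename₀₁⁺ φ
    rename₀₁⁻ (φ ∧ᶠ ψ) (s , t) = rename₀₁⁻ φ s , rename₀₁⁻ ψ t
    rename₀₁⁻ (φ ∨ᶠ ψ) s (¬s , ¬t) = s (¬s ∘ rename₀₁⁻ φ , ¬t ∘ rename₀₁⁻ ψ)
    rename₀₁⁻ (φ ⇒ᶠ ψ) s       = rename₀₁⁻ ψ ∘ s ∘ rename₀₁⁺ φ
    rename₀₁⁻ (φ ⇔ᶠ ψ) (s , t) = rename₀₁⁻ ψ ∘ s ∘ rename₀₁⁺ φ , rename₀₁⁻ φ ∘ t ∘ rename₀₁⁺ ψ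
    rename₀₁⁻ (∀ᶠ x φ) s d     = rename₀₁⁻ φ (s d)
    rename₀₁⁻ (∃ᶠ x φ) s ¬s    = s (λ d → ¬s d ∘ rename₀₁⁻ φ)

QF : Formula → Set
QF (¬ᶠ φ)   = QF φ
QF (φ ∧ᶠ ψ) = QF φ × QF ψ
QF (φ ∨ᶠ ψ) = QF φ × QF ψ
QF (φ ⇒ᶠ ψ) = QF φ × QF ψ
QF (φ ⇔ᶠ ψ) = QF φ × QF ψ
QF (∀ᶠ x φ) = ⊥
QF (∃ᶠ x φ) = ⊥
QF _        = ⊤

-- The value false on quantifiers is junk: truth is only used on QF formulas.
truth : (M : Structure) → Assignment M → Formula → Bool
truth M σ ⊤ᶠ       = true
truth M σ ⊥ᶠ       = false
truth M σ (atomᶠ (atom i (patom p ts))) = rel M i p (evalTs M σ ts)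
truth M σ (¬ᶠ φ)   = not (truth M σ φ)
truth M σ (φ ∧ᶠ ψ) = truth M σ φ ∧ truth M σ ψ
truth M σ (φ ∨ᶠ ψ) = truth M σ φ ∨ truth M σ ψ
truth M σ (φ ⇒ᶠ ψ) = not (truth M σ φ) ∨ truth M σ ψ
truth M σ (φ ⇔ᶠ ψ) = (not (truth M σ φ) ∨ truth M σ ψ) ∧ (not (truth M σ ψ) ∨ truth M σ φ)
truth M σ (∀ᶠ x φ) = false
truth M σ (∃ᶠ x φ) = false

not-∧-not : ∀ a b → not (not a ∧ not b) ≡ a ∨ b
not-∧-not true  b = refl
not-∧-not false b = not-involutive b

module _ {M : Structure} {σ : Assignment M} where
  Sat-reflects : ∀ φ → QF φ → Reflects (Sat M σ φ) (truth M σ φ)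
  Sat-reflects ⊤ᶠ       _       = of tt
  Sat-reflects ⊥ᶠ       _       = of id
  Sat-reflects (atomᶠ (atom i (patom p ts))) _ = T-reflects _
  Sat-reflects (¬ᶠ φ)   qφ      = ¬-reflects (Sat-reflects φ qφ)
  Sat-reflects (φ ∧ᶠ ψ) (qφ , qψ) = Sat-reflects φ qφ ×-reflects Sat-reflects ψ qψ
  Sat-reflects (φ ∨ᶠ ψ) (qφ , qψ) = subst (Reflects _) (not-∧-not (truth M σ φ) (truth M σ ψ))
    (¬-reflects (¬-reflects (Sat-reflects φ qφ) ×-reflects ¬-reflects (Sat-reflects ψ qψ)))
  Sat-reflects (φ ⇒ᶠ ψ) (qφ , qψ) = Sat-reflects φ qφ →-reflects Sat-reflects ψ qψ
  Sat-reflects (φ ⇔ᶠ ψ) (qφ , qψ) =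
    (Sat-reflects φ qφ →-reflects Sat-reflects ψ qψ) ×-reflects
    (Sat-reflects ψ qψ →-reflects Sat-reflects φ qφ)

reflects⇒ : ∀ {A B : Set} {b} → Reflects A b → Reflects B b → A → B
reflects⇒ _        (ofʸ b) _ = b
reflects⇒ (ofⁿ ¬a) (ofⁿ _) a = contradiction a ¬a

Sat-transport : ∀ {M N : Structure} {σ : Assignment M} {τ : Assignment N} φ ψ → QF φ → QF ψ →
                truth M σ φ ≡ truth N τ ψ → Sat M σ φ → Sat N τ ψ
Sat-transport φ ψ qφ qψ eq = reflects⇒ (subst (Reflects _) eq (Sat-reflects φ qφ)) (Sat-reflects ψ qψ)

override : ∀ {D : Set} → (ℕ → D) → List ℕ → (ℕ → D) → ℕ → D
override σ []       ρ = σ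
override σ (y ∷ ys) ρ = override (λ x → if x ≡ᵇ y then ρ y else σ x) ys ρ

module _ {D : Set} {ρ : ℕ → D} where
  override-agrees : ∀ {σ : ℕ → D} ys {x} → σ x ≡ ρ x → override σ ys ρ x ≡ ρ x
  override-agrees         []       eq = eq
  override-agrees {σ = σ} (y ∷ ys) {x} eq = override-agrees ys update-agrees
    where
    update-agrees : (if x ≡ᵇ y then ρ y else σ x) ≡ ρ x
    update-agrees with x ≡ᵇ y | ≡ᵇ⇒≡ x y
    ... | true  | x≡y = cong ρ (sym (x≡y tt))
    ... | false | _   = eq

  override-∈ : ∀ {σ : ℕ → D} {ys x} → x ∈ ys → override σ ys ρ x ≡ ρ x
  override-∈ {σ = σ} {y ∷ ys} {x} (here refl) = override-agrees ys update-self
    where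
    update-self : (if x ≡ᵇ x then ρ x else σ x) ≡ ρ x
    update-self with x ≡ᵇ x | ≡⇒≡ᵇ x x refl
    ... | true | _ = refl
  override-∈ {ys = y ∷ ys} (there x∈) = override-∈ x∈

Valid : (M : Structure) → Formula → Set
Valid M φ = (ρ : Assignment M) → Sat M ρ φ

Models : Structure → List Clause → Set
Models M = All (Valid M ∘ clauseF)

module _ {M : Structure} where
  ∀*-elim : ∀ {σ} xs → Sat M σ (∀* xs φ) → (ρ : Assignment M) → Sat M (override σ xs ρ) φ
  ∀*-elim []       s ρ = s
  ∀*-elim (x ∷ xs) s ρ = ∀*-elim xs (s (ρ x)) ρ

  ∀*-intro : ∀ {σ} xs → Valid M φ → Sat M σ (∀* xs φ)
  ∀*-intro []       v   = v _
  ∀*-intro (x ∷ xs) v d = ∀*-intro xs v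

  ∀*-map : ∀ {σ} xs → (∀ {ρ} → Sat M ρ φ → Sat M ρ ψ) → Sat M σ (∀* xs φ) → Sat M σ (∀* xs ψ)
  ∀*-map []       f s   = f s
  ∀*-map (x ∷ xs) f s d = ∀*-map xs f (s d)

QF-⋀-map : ∀ {A : Set} (f : A → Formula) → (∀ x → QF (f x)) → ∀ xs → QF (⋀ (map f xs))
QF-⋀-map f qf []       = tt
QF-⋀-map f qf (x ∷ xs) = qf x , QF-⋀-map f qf xs

QF-⋁-map : ∀ {A : Set} (f : A → Formula) → (∀ x → QF (f x)) → ∀ xs → QF (⋁ (map f xs))
QF-⋁-map f qf []       = tt
QF-⋁-map f qf (x ∷ xs) = qf x , QF-⋁-map f qf xs

QF-litF : ∀ l → QF (litF l)
QF-litF (lit true  _) = tt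
QF-litF (lit false _) = tt

QF-clauseF : ∀ c → QF (clauseF c)
QF-clauseF = QF-⋁-map litF QF-litF

litAtom : Literal → PAtom
litAtom l = Atom.pa (Literal.latom l)

module _ {M : Structure} {σ ρ : Assignment M} where
  litF-coincidence : ∀ l → (∀ {x} → x ∈ varsPA (litAtom l) → σ x ≡ ρ x) →
                     truth M σ (litF l) ≡ truth M ρ (litF l)
  litF-coincidence (lit true  (atom i (patom p ts))) agree =
    cong (rel M i p) (evalTs-coincidence ts agree)
  litF-coincidence (lit false (atom i (patom p ts))) agree =
    cong (not ∘ rel M i p) (evalTs-coincidence ts agree)

  clauseF-coincidence : ∀ c → (∀ {x} → x ∈ clauseVars c → σ x ≡ ρ x) →
                        truth M σ (clauseF c) ≡ truth M ρ (clauseF c)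
  clauseF-coincidence []      agree = refl
  clauseF-coincidence (l ∷ c) agree =
    cong₂ _∨_ (litF-coincidence l (agree ∘ ∈-++⁺ˡ)) (clauseF-coincidence c (agree ∘ ∈-++⁺ʳ _))

Sat-override-clause : ∀ {M σ ρ} c → clauseVars c ⊆ xs →
                      Sat M (override σ xs ρ) (clauseF c) → Sat M ρ (clauseF c)
Sat-override-clause c c⊆xs =
  Sat-transport (clauseF c) (clauseF c) (QF-clauseF c) (QF-clauseF c)
    (clauseF-coincidence c (override-∈ ∘ c⊆xs))

Valid-cnf : ∀ {M Cs} → Models M Cs → Valid M (cnf Cs)
Valid-cnf []       ρ = tt
Valid-cnf (v ∷ vs) ρ = v ρ , Valid-cnf vs ρ

module _ {M : Structure} {σ : Assignment M} where
  ∀*-cnf⁻ : ∀ {Cs} → All (λ c → clauseVars c ⊆ xs) Cs → Sat M σ (∀* xs (cnf Cs)) → Models M Cs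
  ∀*-cnf⁻               []              s = []
  ∀*-cnf⁻ {xs} {c ∷ Cs} (c⊆xs ∷ closed) s =
    (λ ρ → Sat-override-clause c c⊆xs (proj₁ (∀*-elim xs s ρ))) ∷ ∀*-cnf⁻ closed (∀*-map xs proj₂ s)

  ∀*-cnf₂⁻ : ∀ xs Ms {Ns} → All (λ c → clauseVars c ⊆ xs) (Ms ++ Ns) →
             Sat M σ (∀* xs (cnf Ms ∧ᶠ cnf Ns)) → Models M (Ms ++ Ns)
  ∀*-cnf₂⁻ xs Ms closed s =
    let closedMs , closedNs = Allₚ.++⁻ Ms closed
    in Allₚ.++⁺ (∀*-cnf⁻ closedMs (∀*-map xs proj₁ s)) (∀*-cnf⁻ closedNs (∀*-map xs proj₂ s))

  ∀*-cnf₂⁺ : ∀ xs Ms {Ns} → Models M (Ms ++ Ns) → Sat M σ (∀* xs (cnf Ms ∧ᶠ cnf Ns))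
  ∀*-cnf₂⁺ xs Ms models =
    let modelsMs , modelsNs = Allₚ.++⁻ Ms models
    in ∀*-intro xs (λ ρ → Valid-cnf modelsMs ρ , Valid-cnf modelsNs ρ)

select-⊆ : ∀ b i c → select b i c ⊆ map litAtom c
select-⊆ b i []                       ()
select-⊆ b i (lit b′ (atom j A) ∷ c) with (b ==ᵇ b′) ∧ (i ==ˢ j)
... | true  = λ { (here refl) → here refl ; (there A∈) → there (select-⊆ b i c A∈) }
... | false = there ∘ select-⊆ b i c

select-∷ : ∀ b i l c → select b i c ⊆ select b i (l ∷ c)
select-∷ b i (lit b′ (atom j A)) c with (b ==ᵇ b′) ∧ (i ==ˢ j)
... | true  = there
... | false = id

∈-select : ∀ {b i A c} → lit b (atom i A) ∈ c → A ∈ select b i c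
∈-select {true}  {s0} (here refl) = here refl
∈-select {true}  {s1} (here refl) = here refl
∈-select {false} {s0} (here refl) = here refl
∈-select {false} {s1} (here refl) = here refl
∈-select {b} {i} {c = l ∷ c} (there l∈) = select-∷ b i l c (∈-select l∈)

ruleAtoms-clauseToRule⁻ : ∀ c → ruleAtoms (clauseToRule c) ⊆ map litAtom c
ruleAtoms-clauseToRule⁻ c =
  ++-⊆ (select-⊆ true s0 c) (++-⊆ (select-⊆ false s1 c) (++-⊆ (select-⊆ false s0 c) (select-⊆ true s1 c)))

ruleAtoms-clauseToRule⁺ : ∀ c l → l ∈ c → litAtom l ∈ ruleAtoms (clauseToRule c)
ruleAtoms-clauseToRule⁺ c (lit true  (atom s0 A)) l∈ = ∈-++⁺ˡ (∈-select l∈)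
ruleAtoms-clauseToRule⁺ c (lit false (atom s1 A)) l∈ = ∈-++⁺ʳ (select true s0 c) (∈-++⁺ˡ (∈-select l∈))
ruleAtoms-clauseToRule⁺ c (lit false (atom s0 A)) l∈ =
  ∈-++⁺ʳ (select true s0 c) (∈-++⁺ʳ (select false s1 c) (∈-++⁺ˡ (∈-select l∈)))
ruleAtoms-clauseToRule⁺ c (lit true  (atom s1 A)) l∈ =
  ∈-++⁺ʳ (select true s0 c) (∈-++⁺ʳ (select false s1 c) (∈-++⁺ʳ (select false s0 c) (∈-select l∈)))

clauseVars⊆ruleVars : ∀ c → clauseVars c ⊆ ruleVars (clauseToRule c)
clauseVars⊆ruleVars c =
  concatMap-⊆ {xs = c} λ {l} l∈ → concatMap-∈ varsPA (ruleAtoms-clauseToRule⁺ c l l∈)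

ruleBody : Sup → Rule → Formula
ruleBody i (rule hp hn bp bn) =
  ⋀ (map (λ A → atomᶠ (atom i A)) bp) ∧ᶠ ⋀ (map (λ A → ¬ᶠ atomᶠ (A ¹)) bn)
    ⇒ᶠ ⋁ (map (λ A → atomᶠ (atom i A)) hp) ∨ᶠ ⋁ (map (λ A → ¬ᶠ atomᶠ (A ¹)) hn)

QF-ruleBody : ∀ i r → QF (ruleBody i r)
QF-ruleBody i (rule hp hn bp bn) =
  (QF-⋀-map _ (λ _ → tt) bp , QF-⋀-map _ (λ _ → tt) bn) ,
  (QF-⋁-map _ (λ _ → tt) hp , QF-⋁-map _ (λ _ → tt) hn)

-- The truth value  not (b ∧ n) ∨ (h ∨ k)  of a rule body, with the value a of one
-- more literal added to one of its four parts and then moved to the front.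
head-shift⁺ : ∀ u a h k → u ∨ ((a ∨ h) ∨ k) ≡ a ∨ (u ∨ (h ∨ k))
head-shift⁺ true  true  h k = refl
head-shift⁺ true  false h k = refl
head-shift⁺ false true  h k = refl
head-shift⁺ false false h k = refl

head-shift⁻ : ∀ u a h k → u ∨ (h ∨ (a ∨ k)) ≡ a ∨ (u ∨ (h ∨ k))
head-shift⁻ true  true  h     k = refl
head-shift⁻ true  false h     k = refl
head-shift⁻ false true  true  k = refl
head-shift⁻ false false true  k = refl
head-shift⁻ false a     false k = refl

body-shift⁺ : ∀ a b n r → not ((a ∧ b) ∧ n) ∨ r ≡ not a ∨ (not (b ∧ n) ∨ r)
body-shift⁺ true  b n r = refl
body-shift⁺ false b n r = refl

body-shift⁻ : ∀ a b n r → not (b ∧ (not a ∧ n)) ∨ r ≡ a ∨ (not (b ∧ n) ∨ r)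
body-shift⁻ true  true  n r = refl
body-shift⁻ false true  n r = refl
body-shift⁻ true  false n r = refl
body-shift⁻ false false n r = refl

module _ {M : Structure} {σ : Assignment M} where
  truth-reading⁰ : ∀ i A → truth (reading i M) σ (atomᶠ (A ⁰)) ≡ truth M σ (atomᶠ (atom i A))
  truth-reading⁰ s0 A            = refl
  truth-reading⁰ s1 (patom p ts) = cong (rel M s1 p) (evalTs-reading s1 ts)

  truth-reading¹ : ∀ i A → truth (reading i M) σ (atomᶠ (A ¹)) ≡ truth M σ (atomᶠ (A ¹))
  truth-reading¹ s0 A            = refl
  truth-reading¹ s1 (patom p ts) = cong (rel M s1 p) (evalTs-reading s1 ts)

module _ {M : Structure} {σ : Assignment M} (i : Sup) where
  private
    body⁺ body⁻ head⁺ head⁻ : Clause → Bool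
    body⁺ c = truth M σ (⋀ (map (λ A → atomᶠ (atom i A)) (select false s0 c)))
    body⁻ c = truth M σ (⋀ (map (λ A → ¬ᶠ atomᶠ (A ¹)) (select true s1 c)))
    head⁺ c = truth M σ (⋁ (map (λ A → atomᶠ (atom i A)) (select true s0 c)))
    head⁻ c = truth M σ (⋁ (map (λ A → ¬ᶠ atomᶠ (A ¹)) (select false s1 c)))

  truth-ruleBody : ∀ c → truth M σ (ruleBody i (clauseToRule c)) ≡ truth (reading i M) σ (clauseF c)
  truth-ruleBody [] = refl
  truth-ruleBody (lit true (atom s0 A) ∷ c) =
    trans (head-shift⁺ (not (body⁺ c ∧ body⁻ c)) (truth M σ (atomᶠ (atom i A))) (head⁺ c) (head⁻ c))
          (cong₂ _∨_ (sym (truth-reading⁰ i A)) (truth-ruleBody c))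
  truth-ruleBody (lit false (atom s1 A) ∷ c) =
    trans (head-shift⁻ (not (body⁺ c ∧ body⁻ c)) (not (truth M σ (atomᶠ (A ¹)))) (head⁺ c) (head⁻ c))
          (cong₂ _∨_ (cong not (sym (truth-reading¹ i A))) (truth-ruleBody c))
  truth-ruleBody (lit false (atom s0 A) ∷ c) =
    trans (body-shift⁺ (truth M σ (atomᶠ (atom i A))) (body⁺ c) (body⁻ c) (head⁺ c ∨ head⁻ c))
          (cong₂ _∨_ (cong not (sym (truth-reading⁰ i A))) (truth-ruleBody c))
  truth-ruleBody (lit true (atom s1 A) ∷ c) =
    trans (body-shift⁻ (truth M σ (atomᶠ (A ¹))) (body⁺ c) (body⁻ c) (head⁺ c ∨ head⁻ c))
          (cong₂ _∨_ (sym (truth-reading¹ i A)) (truth-ruleBody c))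

module _ {M : Structure} {σ : Assignment M} where
  Sat-γʳ⁻ : ∀ i c → Sat M σ (γʳ i (clauseToRule c)) → Valid (reading i M) (clauseF c)
  Sat-γʳ⁻ i c s ρ =
    Sat-override-clause c (clauseVars⊆ruleVars c)
      (Sat-transport (ruleBody i r) (clauseF c) (QF-ruleBody i r) (QF-clauseF c) (truth-ruleBody i c)
        (∀*-elim (ruleVars r) s ρ))
    where r = clauseToRule c

  Sat-γʳ⁺ : ∀ i c → Valid (reading i M) (clauseF c) → Sat M σ (γʳ i (clauseToRule c))
  Sat-γʳ⁺ i c v = ∀*-intro (ruleVars r) λ ρ →
    Sat-transport (clauseF c) (ruleBody i r) (QF-clauseF c) (QF-ruleBody i r)
      (sym (truth-ruleBody i c)) (v ρ)
    where r = clauseToRule c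

  Sat-⋀γʳ⁻ : ∀ i Cs → Sat M σ (⋀ (map (γʳ i) (map clauseToRule Cs))) → Models (reading i M) Cs
  Sat-⋀γʳ⁻ i []       _        = []
  Sat-⋀γʳ⁻ i (c ∷ Cs) (s , ss) = Sat-γʳ⁻ i c s ∷ Sat-⋀γʳ⁻ i Cs ss

  Sat-⋀γʳ⁺ : ∀ i {Cs} → Models (reading i M) Cs → Sat M σ (⋀ (map (γʳ i) (map clauseToRule Cs)))
  Sat-⋀γʳ⁺ i []       = tt
  Sat-⋀γʳ⁺ i {c ∷ _} (v ∷ vs) = Sat-γʳ⁺ i c v , Sat-⋀γʳ⁺ i vs

  Sat-γ-procedure⁻ : ∀ Ms Ns → Sat M σ (γ (procedure Ms Ns)) →
                     Models M (Ms ++ Ns) × Models (reading s1 M) (Ms ++ Ns)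
  Sat-γ-procedure⁻ Ms Ns (γ⁰ , γ¹) = Sat-⋀γʳ⁻ s0 (Ms ++ Ns) γ⁰ , Sat-⋀γʳ⁻ s1 (Ms ++ Ns) γ¹

  Sat-γ-procedure⁺ : ∀ Ms Ns → Models M (Ms ++ Ns) → Models (reading s1 M) (Ms ++ Ns) →
                     Sat M σ (γ (procedure Ms Ns))
  Sat-γ-procedure⁺ Ms Ns models⁰ models¹ = Sat-⋀γʳ⁺ s0 models⁰ , Sat-⋀γʳ⁺ s1 models¹

Pred-∀*⁺ : ∀ xs → Pred φ ⊆ Pred (∀* xs φ)
Pred-∀*⁺ []       = id
Pred-∀*⁺ (x ∷ xs) = Pred-∀*⁺ xs

Fun-∀*⁺ : ∀ xs → Fun φ ⊆ Fun (∀* xs φ)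
Fun-∀*⁺ []       = id
Fun-∀*⁺ (x ∷ xs) = Fun-∀*⁺ xs

Pred-⋀ : ∀ {φs} → φ ∈ φs → Pred φ ⊆ Pred (⋀ φs)
Pred-⋀              (here refl) = ∈-++⁺ˡ
Pred-⋀ {φs = ψ ∷ _} (there φ∈)  = ∈-++⁺ʳ (Pred ψ) ∘ Pred-⋀ φ∈

Pred-⋁ : ∀ {φs} → φ ∈ φs → Pred φ ⊆ Pred (⋁ φs)
Pred-⋁              (here refl) = ∈-++⁺ˡ
Pred-⋁ {φs = ψ ∷ _} (there φ∈)  = ∈-++⁺ʳ (Pred ψ) ∘ Pred-⋁ φ∈

Fun-⋀ : ∀ {φs} → φ ∈ φs → Fun φ ⊆ Fun (⋀ φs)
Fun-⋀              (here refl) = ∈-++⁺ˡ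
Fun-⋀ {φs = ψ ∷ _} (there φ∈)  = ∈-++⁺ʳ (Fun ψ) ∘ Fun-⋀ φ∈

Fun-⋁ : ∀ {φs} → φ ∈ φs → Fun φ ⊆ Fun (⋁ φs)
Fun-⋁              (here refl) = ∈-++⁺ˡ
Fun-⋁ {φs = ψ ∷ _} (there φ∈)  = ∈-++⁺ʳ (Fun ψ) ∘ Fun-⋁ φ∈

Pred-litF : ∀ l → (litSup l , PAtom.pred (litAtom l)) ∈ Pred (litF l)
Pred-litF (lit true  _) = here refl
Pred-litF (lit false _) = here refl

Fun-litF : ∀ l → funsPA (litAtom l) ⊆ Fun (litF l)
Fun-litF (lit true  _) = id
Fun-litF (lit false _) = id

PredP-clauseToRule : ∀ c → map PAtom.pred (ruleAtoms (clauseToRule c)) ⊆ PredLP (clauseF c)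
PredP-clauseToRule c p∈ with ∈-map⁻ PAtom.pred p∈
... | A , A∈ , refl with ∈-map⁻ litAtom (ruleAtoms-clauseToRule⁻ c A∈)
...   | l , l∈ , refl = ∈-map⁺ proj₂ (Pred-⋁ (∈-map⁺ litF l∈) (Pred-litF l))

FunP-clauseToRule : ∀ c → concatMap funsPA (ruleAtoms (clauseToRule c)) ⊆ Fun (clauseF c)
FunP-clauseToRule c = concatMap-⊆ λ A∈ → case ∈-map⁻ litAtom (ruleAtoms-clauseToRule⁻ c A∈) of λ where
  (l , l∈ , refl) → Fun-⋁ (∈-map⁺ litF l∈) ∘ Fun-litF l

PredP-procedure : ∀ φ {Cs} → All (λ c → Pred (clauseF c) ⊆ Pred φ) Cs →
                  PredP (map clauseToRule Cs) ⊆ PredLP φ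
PredP-procedure φ clauses⊆ = concatMap-⊆ λ r∈ → case ∈-map⁻ clauseToRule r∈ of λ where
  (c , c∈ , refl) → Subset.map⁺ proj₂ (All.lookup clauses⊆ c∈) ∘ PredP-clauseToRule c

FunP-procedure : ∀ φ {Cs} → All (λ c → Fun (clauseF c) ⊆ Fun φ) Cs →
                 FunP (map clauseToRule Cs) ⊆ Fun φ
FunP-procedure φ clauses⊆ = concatMap-⊆ λ r∈ → case ∈-map⁻ clauseToRule r∈ of λ where
  (c , c∈ , refl) → All.lookup clauses⊆ c∈ ∘ FunP-clauseToRule c

Pred-clause-cnf₂ : ∀ xs Ms {Ns c} → c ∈ Ms ++ Ns → Pred (clauseF c) ⊆ Pred (∀* xs (cnf Ms ∧ᶠ cnf Ns))
Pred-clause-cnf₂ xs Ms c∈ with ∈-++⁻ Ms c∈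
... | inj₁ c∈Ms = Pred-∀*⁺ xs ∘ ∈-++⁺ˡ ∘ Pred-⋀ (∈-map⁺ clauseF c∈Ms)
... | inj₂ c∈Ns = Pred-∀*⁺ xs ∘ ∈-++⁺ʳ _ ∘ Pred-⋀ (∈-map⁺ clauseF c∈Ns)

Fun-clause-cnf₂ : ∀ xs Ms {Ns c} → c ∈ Ms ++ Ns → Fun (clauseF c) ⊆ Fun (∀* xs (cnf Ms ∧ᶠ cnf Ns))
Fun-clause-cnf₂ xs Ms c∈ with ∈-++⁻ Ms c∈
... | inj₁ c∈Ms = Fun-∀*⁺ xs ∘ ∈-++⁺ˡ ∘ Fun-⋀ (∈-map⁺ clauseF c∈Ms)
... | inj₂ c∈Ns = Fun-∀*⁺ xs ∘ ∈-++⁺ʳ _ ∘ Fun-⋀ (∈-map⁺ clauseF c∈Ns)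

module _ {A : Set} {P : A → Set} (Ms : List A) {Ns Ns′ Ns″ : List A} (Ns↭ : Ns ↭ Ns′ ++ Ns″) where
  All-↭-split : All P (Ms ++ Ns) → All P (Ms ++ Ns′) × All P Ns″
  All-↭-split all =
    let allMs , allNs = Allₚ.++⁻ Ms all
        allNs′ , allNs″ = Allₚ.++⁻ Ns′ (All-resp-↭ Ns↭ allNs)
    in Allₚ.++⁺ allMs allNs′ , allNs″

  All-↭-merge : All P (Ms ++ Ns′) → All P Ns″ → All P (Ms ++ Ns)
  All-↭-merge all allNs″ =
    let allMs , allNs′ = Allₚ.++⁻ Ms all
    in Allₚ.++⁺ allMs (All-resp-↭ (↭-sym Ns↭) (Allₚ.++⁺ allNs′ allNs″))

proposition3 :
    (F : Formula) → EncodesLP F →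
    -- (1) a CNF  ∀x̄ (M₀ ∧ M₁)  of F
    (xs : List ℕ) (M₀ M₁ : List Clause) →
    F ≡ᶠ ∀* xs (cnf M₀ ∧ᶠ cnf M₁) →
    All (λ c → clauseVars c ⊆ xs) (M₀ ++ M₁) →
    PredLP (∀* xs (cnf M₀ ∧ᶠ cnf M₁)) ⊆ PredLP F →
    Fun (∀* xs (cnf M₀ ∧ᶠ cnf M₁)) ⊆ Fun F →
    All Has0 M₀ → All All1 M₁ →
    -- (2) a partition of M₁ into M₁' and M₁''
    (M₁' M₁'' : List Clause) → M₁ ↭ M₁' ++ M₁'' →
    ∀* xs (rename₀₁ (cnf M₀)) ⊨ ∀* xs (cnf M₁'') →
    -- (3) the output P
    (F ∣S⊨ (γ (procedure M₀ M₁') ⇔ᶠ F))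
      × PredP (procedure M₀ M₁') ⊆ PredLP F
      × FunP (procedure M₀ M₁') ⊆ Fun F
proposition3 F (_ , encodes) xs M₀ M₁ (F⊨G , G⊨F) closed predG⊆ funG⊆ _ _ M₁' M₁'' M₁↭ M₀¹⊨M₁'' =
  (λ M σ S → γ⇒F M σ , F⇒γ M σ S) , predP⊆ , funP⊆
  where
  G : Formula
  G = ∀* xs (cnf M₀ ∧ᶠ cnf M₁)

  restrict : ∀ {P : Clause → Set} → All P (M₀ ++ M₁) → All P (M₀ ++ M₁')
  restrict = proj₁ ∘ All-↭-split M₀ M₁↭

  models : ∀ N {σ} → Sat N σ F → Models N (M₀ ++ M₁)
  models N f = ∀*-cnf₂⁻ xs M₀ closed (F⊨G N _ f)

  γ⇒F : ∀ M σ → Sat M σ (γ (procedure M₀ M₁')) → Sat M σ F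
  γ⇒F M σ γP =
    let models⁰ , models¹ = Sat-γ-procedure⁻ M₀ M₁' γP
        renamed-M₀ = ∀*-intro xs (rename₀₁⁺ (cnf M₀) ∘ Valid-cnf (Allₚ.++⁻ˡ M₀ models¹))
        models″ = ∀*-cnf⁻ (proj₂ (All-↭-split M₀ M₁↭ closed)) (M₀¹⊨M₁'' M σ renamed-M₀)
    in G⊨F M σ (∀*-cnf₂⁺ xs M₀ (All-↭-merge M₀ M₁↭ models⁰ models″))

  F⇒γ : ∀ M σ → SatS F M → Sat M σ F → Sat M σ (γ (procedure M₀ M₁'))
  F⇒γ M σ S f =
    Sat-γ-procedure⁺ M₀ M₁' (restrict (models M f))
      (restrict (models (reading s1 M) (rename₀₁⁻ F (encodes M σ S f))))

  predP⊆ : PredP (procedure M₀ M₁') ⊆ PredLP F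
  predP⊆ = predG⊆ ∘ PredP-procedure G (restrict (All.tabulate (Pred-clause-cnf₂ xs M₀)))

  funP⊆ : FunP (procedure M₀ M₁') ⊆ Fun F
  funP⊆ = funG⊆ ∘ FunP-procedure G (restrict (All.tabulate (Fun-clause-cnf₂ xs M₀)))
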